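{- Let $n\ge1$, $d=\binom{n+1}2$, and let $(\gamma_0,\dots,\gamma_{\lfloor d/2\rfloor})$ be the $\gamma$-vector of $\prod_{j=1}^n(1+q^j)$. Then for each $i$, $$\gamma_i=(-1)^i\left|\bigcup_{j_1+j_2+\cdots+j_n=i}T'(1,j_1)\times T'(2,j_2)\times\cdots\times T'(n,j_n)\right|,$$ i.e. $(-1)^i\gamma_i$ is the number of $n$-tuples $(M_1,\dots,M_n)$, where $M_m$ is a matching of the $m$-cycle graph, having $i$ edges in total.
   Context: The $\gamma$-vector of a polynomial $h$ with $q^dh(1/q)=h(q)$ (palindromic degree $d$) is the unique $(\gamma_0,\dots,\gamma_{\lfloor d/2\rfloor})$ with $h(q)=\sum_{0\le2i\le d}\gamma_iq^i(1+q)^{d-2i}$. $T'(m,j)$ is the set of matchings with exactly $j$ edges of the $m$-cycle graph (the cycle with $m$ vertices and $m$ edges; for $m=1$ a single vertex with a loop, which is never used in a matching; for $m=2$ two vertices joined by two parallel edges), so that $|T'(m,j)|=\frac{m}{m-j}\binom{m-j}{j}$. -}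

module Defs where

open import Data.Nat as ℕ using (ℕ; zero; suc; _∸_; _/_)
open import Data.Nat.Combinatorics using (_C_)
open import Data.Integer as ℤ using (ℤ; +_; _+_; _*_; -_)
open import Data.Fin as Fin using (Fin; toℕ; fromℕ<)
open import Data.Fin.Subset using (Subset; ∣_∣)
open import Data.Vec using (Vec; []; _∷_; lookup)
open import Data.List as List using (List; []; _∷_; allFin; concatMap; filterᵇ; length)
open import Data.Bool using (Bool; true; false; _∧_; _∨_; not; if_then_else_)
open import Data.Product using (_×_; _,_)
open import Data.Unit using (⊤; tt)
open import Relation.Nullary.Decidable using (⌊_⌋)
open import Relation.Binary.PropositionalEquality using (_≡_)

-- Polynomials in q with integer coefficients, as coefficient functions
-- (coefficient of q^k is p k).  All polynomials below have finite support.

Poly : Set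
Poly = ℕ → ℤ

sumUpTo : ℕ → (ℕ → ℤ) → ℤ
sumUpTo zero    f = f 0
sumUpTo (suc k) f = sumUpTo k f + f (suc k)

_⊕_ : Poly → Poly → Poly
(p ⊕ r) k = p k + r k

_⊗_ : Poly → Poly → Poly
(p ⊗ r) k = sumUpTo k (λ a → p a * r (k ∸ a))

zeroP : Poly
zeroP _ = + 0

oneP : Poly
oneP zero    = + 1
oneP (suc _) = + 0

X^ : ℕ → Poly
X^ j k = if ⌊ k ℕ.≟ j ⌋ then + 1 else + 0

scale : ℤ → Poly → Poly
scale c p k = c * p k

_^P_ : Poly → ℕ → Poly
p ^P zero  = oneP
p ^P suc m = p ⊗ (p ^P m)

onePlusQ : Poly
onePlusQ = oneP ⊕ X^ 1

_≈P_ : Poly → Poly → Set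
p ≈P r = ∀ k → p k ≡ r k

gammaExpansion : (d : ℕ) → (Fin (suc (d / 2)) → ℤ) → Poly
gammaExpansion d γ = List.foldr _⊕_ zeroP
  (List.map (λ i → scale (γ i) (X^ (toℕ i) ⊗ (onePlusQ ^P (d ∸ 2 ℕ.* toℕ i))))
            (allFin (suc (d / 2))))

IsGammaVector : Poly → (d : ℕ) → (Fin (suc (d / 2)) → ℤ) → Set
IsGammaVector h d γ = h ≈P gammaExpansion d γ

prodPoly : ℕ → Poly
prodPoly zero    = oneP
prodPoly (suc n) = prodPoly n ⊗ (oneP ⊕ X^ (suc n))

-- Vertices and edges are both indexed by Fin m; edge e joins vertex e
-- and vertex (e + 1 mod m).  For m = 1 edge 0 is a loop at vertex 0;
-- for m = 2 edges 0 and 1 are two parallel edges between 0 and 1.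
-- An edge set is a Subset m (edge e chosen iff lookup S e ≡ true).

src : {m : ℕ} → Fin m → Fin m
src e = e

tgt : {m : ℕ} → Fin m → Fin m
tgt {suc m} e = fromℕ< (Data.Nat.DivMod.m%n<n (suc (toℕ e)) (suc m))
  where import Data.Nat.DivMod
tgt {zero} ()

isLoop : {m : ℕ} → Fin m → Bool
isLoop e = ⌊ src e Fin.≟ tgt e ⌋

_≠ᵇ_ : {m : ℕ} → Fin m → Fin m → Bool
a ≠ᵇ b = not ⌊ a Fin.≟ b ⌋

disjointᵇ : {m : ℕ} → Fin m → Fin m → Bool
disjointᵇ e f = (src e ≠ᵇ src f) ∧ (src e ≠ᵇ tgt f) ∧ (tgt e ≠ᵇ src f) ∧ (tgt e ≠ᵇ tgt f)

allᵇ : {A : Set} → (A → Bool) → List A → Bool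
allᵇ p xs = List.foldr (λ x b → p x ∧ b) true xs

isMatching : (m : ℕ) → Subset m → Bool
isMatching m S = allᵇ (λ e → not (lookup S e) ∨
                    (not (isLoop e) ∧
                     allᵇ (λ f → not (lookup S f) ∨ ⌊ e Fin.≟ f ⌋ ∨ disjointᵇ e f) (allFin m)))
                  (allFin m)

allSubsets : (m : ℕ) → List (Subset m)
allSubsets zero    = [] ∷ []
allSubsets (suc m) = concatMap (λ S → (false ∷ S) ∷ (true ∷ S) ∷ []) (allSubsets m)

matchings : (m : ℕ) → List (Subset m)
matchings m = filterᵇ (isMatching m) (allSubsets m)

Tuple : ℕ → Set
Tuple zero    = ⊤
Tuple (suc n) = Tuple n × Subset (suc n)

totalEdges : (n : ℕ) → Tuple n → ℕ
totalEdges zero    tt      = 0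
totalEdges (suc n) (t , M) = totalEdges n t ℕ.+ ∣ M ∣

matchingTuples : (n : ℕ) → List (Tuple n)
matchingTuples zero    = tt ∷ []
matchingTuples (suc n) =
  concatMap (λ t → List.map (λ M → t , M) (matchings (suc n))) (matchingTuples n)

countTuples : (n i : ℕ) → ℕ
countTuples n i = length (filterᵇ (λ t → ⌊ totalEdges n t ℕ.≟ i ⌋) (matchingTuples n))

-- Write T(a,e) = (-1)^a q^a (1+q)^e; these are multiplicative in (a,e).  The proof has
-- three steps.
--  1. Cycle identity.  For the m-cycle C_m,  Σ_M T(|M|, m - 2|M|) = 1 + q^m,  the sum over
--     its matchings M.  Edge sets of C_{k+1} are cyclic binary words; giving consecutive
--     letters the weights ff ↦ 1+q, ft ↦ -q, tf ↦ 1, tt ↦ 0, the weight of a word is T(|M|, …)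
--     if it is a matching and 0 otherwise, and the total is the trace of the k+1-st power
--     of the 2×2 transfer matrix, which obeys x_{k+2} = (1+q) x_{k+1} - q x_k, as 1 + q^{k+1} does.
--  2. Product expansion.  Multiplying these identities for m = 1, …, n (d_n = 1 + … + n)
--     gives h_n = Σ_{(M₁,…,M_n)} T(E, d_n - 2E), E the total number of edges; grouping by E
--     exhibits the claimed γ-vector.
--  3. Uniqueness.  q^j (1+q)^{d-2j} = q^j + higher terms, so these polynomials are
--     linearly independent.
module Submission where

open import Defs
open import Data.Nat as ℕ using (ℕ; zero; suc; _∸_; _≤_; _<_; z≤n; s≤s; _/_)
import Data.Nat.Properties as ℕP
import Data.Nat.DivMod as ℕD
open import Data.Nat.Combinatorics using (_C_; nCk+nC[k+1]≡[n+1]C[k+1]; nC1≡n)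
open import Data.Integer as ℤ using (ℤ; +_; -_; _+_; _*_; _^_; _-_)
import Data.Integer.Properties as ℤP
open import Data.Bool using (Bool; true; false; _∧_; _∨_; not; T?; if_then_else_)
import Data.Bool.Properties as BoolP
open import Data.Fin as Fin using (Fin; zero; suc; toℕ; fromℕ; inject₁)
import Data.Fin.Properties as FinP
open import Data.Fin.Subset using (Subset; ∣_∣)
open import Data.Vec using (Vec; []; _∷_; lookup; _∷ʳ_)
open import Data.List using (List; []; _∷_; _++_; map; concatMap; filterᵇ; allFin; foldr; length; tabulate)
import Data.List.Properties as ListP
open import Data.List.Membership.Propositional using (_∈_; find)
open import Data.List.Membership.Propositional.Properties using (∈-allFin; ∈-concatMap⁻; ∈-map⁻; ∈-filter⁻)
open import Data.List.Relation.Unary.Any using (here; there)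
open import Data.Maybe using (Maybe; just; nothing)
open import Data.Product using (Σ; _×_; _,_; proj₁; proj₂)
open import Data.Sum using (_⊎_; inj₁; inj₂)
open import Data.Empty using (⊥; ⊥-elim)
open import Function using (id; _∘_)
open import Function.Bundles using (Equivalence)
open import Relation.Nullary.Decidable using (⌊_⌋; yes; no)
open import Relation.Binary.Bundles using (Setoid)
open import Relation.Binary.Structures using (IsEquivalence)
open import Relation.Binary.PropositionalEquality
import Relation.Binary.Reasoning.Setoid as SetoidReasoning
open import Algebra.Bundles using (CommutativeRing)
open import Algebra.Structures using (IsCommutativeRing)
import Algebra.Solver.Ring.AlmostCommutativeRing as ACR
import Algebra.Properties.CommutativeSemigroup as CommSemigroupProperties

sum-cong : ∀ k {f g : ℕ → ℤ} → (∀ a → a ≤ k → f a ≡ g a) → sumUpTo k f ≡ sumUpTo k g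
sum-cong zero    f≡g = f≡g 0 z≤n
sum-cong (suc k) f≡g =
  cong₂ _+_ (sum-cong k (λ a a≤k → f≡g a (ℕP.m≤n⇒m≤1+n a≤k))) (f≡g (suc k) ℕP.≤-refl)

sum-peel : ∀ k (f : ℕ → ℤ) → sumUpTo (suc k) f ≡ f 0 + sumUpTo k (λ a → f (suc a))
sum-peel zero    f = refl
sum-peel (suc k) f = begin
  sumUpTo (suc k) f + f (suc (suc k))                   ≡⟨ cong (_+ f (suc (suc k))) (sum-peel k f) ⟩
  f 0 + sumUpTo k (λ a → f (suc a)) + f (suc (suc k))   ≡⟨ ℤP.+-assoc (f 0) _ _ ⟩
  f 0 + (sumUpTo k (λ a → f (suc a)) + f (suc (suc k))) ∎
  where open ≡-Reasoning

sum-+ : ∀ k (f g : ℕ → ℤ) → sumUpTo k (λ a → f a + g a) ≡ sumUpTo k f + sumUpTo k g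
sum-+ zero    f g = refl
sum-+ (suc k) f g = begin
  sumUpTo k (λ a → f a + g a) + (f (suc k) + g (suc k))
    ≡⟨ cong (_+ (f (suc k) + g (suc k))) (sum-+ k f g) ⟩
  (sumUpTo k f + sumUpTo k g) + (f (suc k) + g (suc k))
    ≡⟨ CommSemigroupProperties.interchange ℤP.+-commutativeSemigroup (sumUpTo k f) _ _ _ ⟩
  (sumUpTo k f + f (suc k)) + (sumUpTo k g + g (suc k)) ∎
  where open ≡-Reasoning

sum-*ˡ : ∀ k c (f : ℕ → ℤ) → c * sumUpTo k f ≡ sumUpTo k (λ a → c * f a)
sum-*ˡ zero    c f = refl
sum-*ˡ (suc k) c f =
  trans (ℤP.*-distribˡ-+ c (sumUpTo k f) _) (cong (_+ c * f (suc k)) (sum-*ˡ k c f))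

sum-zero : ∀ k → sumUpTo k (λ _ → + 0) ≡ + 0
sum-zero zero    = refl
sum-zero (suc k) = cong (_+ + 0) (sum-zero k)

sum-reverse : ∀ k (f : ℕ → ℤ) → sumUpTo k f ≡ sumUpTo k (λ a → f (k ∸ a))
sum-reverse zero    f = refl
sum-reverse (suc k) f = begin
  sumUpTo k f + f (suc k)                  ≡⟨ ℤP.+-comm (sumUpTo k f) _ ⟩
  f (suc k) + sumUpTo k f                  ≡⟨ cong (_+_ (f (suc k))) (sum-reverse k f) ⟩
  f (suc k) + sumUpTo k (λ a → f (k ∸ a))  ≡⟨ sum-peel k (λ a → f (suc k ∸ a)) ⟨
  sumUpTo (suc k) (λ a → f (suc k ∸ a))    ∎
  where open ≡-Reasoning

≈P-refl : ∀ {p} → p ≈P p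
≈P-refl k = refl

≈P-sym : ∀ {p r} → p ≈P r → r ≈P p
≈P-sym p≈r k = sym (p≈r k)

≈P-trans : ∀ {p r s} → p ≈P r → r ≈P s → p ≈P s
≈P-trans p≈r r≈s k = trans (p≈r k) (r≈s k)

≈P-isEquivalence : IsEquivalence _≈P_
≈P-isEquivalence = record { refl = λ {p} → ≈P-refl {p} ; sym = ≈P-sym ; trans = ≈P-trans }

polySetoid : Setoid _ _
polySetoid = record { isEquivalence = ≈P-isEquivalence }

⊕-cong : ∀ {p p' r r'} → p ≈P p' → r ≈P r' → (p ⊕ r) ≈P (p' ⊕ r')
⊕-cong p≈ r≈ k = cong₂ _+_ (p≈ k) (r≈ k)

⊗-cong : ∀ {p p' r r'} → p ≈P p' → r ≈P r' → (p ⊗ r) ≈P (p' ⊗ r')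
⊗-cong p≈ r≈ k = sum-cong k (λ a _ → cong₂ _*_ (p≈ a) (r≈ (k ∸ a)))

⊕-congˡ : ∀ p {r r'} → r ≈P r' → (p ⊕ r) ≈P (p ⊕ r')
⊕-congˡ p = ⊕-cong (≈P-refl {p})

⊕-congʳ : ∀ r {p p'} → p ≈P p' → (p ⊕ r) ≈P (p' ⊕ r)
⊕-congʳ r p≈ = ⊕-cong p≈ (≈P-refl {r})

⊗-congˡ : ∀ p {r r'} → r ≈P r' → (p ⊗ r) ≈P (p ⊗ r')
⊗-congˡ p = ⊗-cong (≈P-refl {p})

⊗-congʳ : ∀ r {p p'} → p ≈P p' → (p ⊗ r) ≈P (p' ⊗ r)
⊗-congʳ r p≈ = ⊗-cong p≈ (≈P-refl {r})

-- The product is the Cauchy product Σ_{a≤k} p_a r_{k-a}; reversing the sum makes it commutative.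
⊗-comm : ∀ p r → (p ⊗ r) ≈P (r ⊗ p)
⊗-comm p r k = trans (sum-reverse k _) (sum-cong k (λ a a≤k →
  trans (ℤP.*-comm (p (k ∸ a)) _) (cong (λ b → r b * p (k ∸ a)) (ℕP.m∸[m∸n]≡n a≤k))))

⊗-distribˡ : ∀ p r s → (p ⊗ (r ⊕ s)) ≈P ((p ⊗ r) ⊕ (p ⊗ s))
⊗-distribˡ p r s k =
  trans (sum-cong k (λ a _ → ℤP.*-distribˡ-+ (p a) (r (k ∸ a)) _)) (sum-+ k _ _)

⊗-distribʳ : ∀ p r s → ((r ⊕ s) ⊗ p) ≈P ((r ⊗ p) ⊕ (s ⊗ p))
⊗-distribʳ p r s = ≈P-trans (⊗-comm (r ⊕ s) p)
  (≈P-trans (⊗-distribˡ p r s) (⊕-cong (⊗-comm p r) (⊗-comm p s)))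

scale-⊗ : ∀ c p r → (scale c p ⊗ r) ≈P scale c (p ⊗ r)
scale-⊗ c p r k = trans (sum-cong k (λ a _ → ℤP.*-assoc c (p a) _)) (sym (sum-*ˡ k c _))

-- Dividing by q: the coefficients of p from degree 1 on.
shift : Poly → Poly
shift p k = p (suc k)

⊗-suc : ∀ p r k → (p ⊗ r) (suc k) ≡ p 0 * r (suc k) + (shift p ⊗ r) k
⊗-suc p r k = sum-peel k _

-- Associativity, by induction on the degree using ⊗-suc (note shift (p ⊗ r) ≈ p₀ · shift r + shift p ⊗ r).
⊗-assoc : ∀ p r s → ((p ⊗ r) ⊗ s) ≈P (p ⊗ (r ⊗ s))
⊗-assoc p r s zero    = ℤP.*-assoc (p 0) (r 0) (s 0)
⊗-assoc p r s (suc k) = begin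
  ((p ⊗ r) ⊗ s) (suc k)
    ≡⟨ ⊗-suc (p ⊗ r) s k ⟩
  p₀r₀ * s (suc k) + (shift (p ⊗ r) ⊗ s) k
    ≡⟨ cong (_+_ (p₀r₀ * s (suc k))) (⊗-congʳ s (⊗-suc p r) k) ⟩
  p₀r₀ * s (suc k) + ((scale (p 0) (shift r) ⊕ (shift p ⊗ r)) ⊗ s) k
    ≡⟨ cong (_+_ (p₀r₀ * s (suc k))) (⊗-distribʳ s (scale (p 0) (shift r)) (shift p ⊗ r) k) ⟩
  p₀r₀ * s (suc k) + ((scale (p 0) (shift r) ⊗ s) k + ((shift p ⊗ r) ⊗ s) k)
    ≡⟨ cong₂ (λ x y → p₀r₀ * s (suc k) + (x + y)) (scale-⊗ (p 0) (shift r) s k) (⊗-assoc (shift p) r s k) ⟩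
  p₀r₀ * s (suc k) + (p 0 * (shift r ⊗ s) k + (shift p ⊗ (r ⊗ s)) k)
    ≡⟨ ℤP.+-assoc (p₀r₀ * s (suc k)) _ _ ⟨
  (p₀r₀ * s (suc k) + p 0 * (shift r ⊗ s) k) + (shift p ⊗ (r ⊗ s)) k
    ≡⟨ cong (λ z → (z + p 0 * (shift r ⊗ s) k) + (shift p ⊗ (r ⊗ s)) k) (ℤP.*-assoc (p 0) (r 0) _) ⟩
  (p 0 * (r 0 * s (suc k)) + p 0 * (shift r ⊗ s) k) + (shift p ⊗ (r ⊗ s)) k
    ≡⟨ cong (_+ (shift p ⊗ (r ⊗ s)) k) (ℤP.*-distribˡ-+ (p 0) _ _) ⟨
  p 0 * (r 0 * s (suc k) + (shift r ⊗ s) k) + (shift p ⊗ (r ⊗ s)) k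
    ≡⟨ cong (λ z → p 0 * z + (shift p ⊗ (r ⊗ s)) k) (⊗-suc r s k) ⟨
  p 0 * (r ⊗ s) (suc k) + (shift p ⊗ (r ⊗ s)) k
    ≡⟨ ⊗-suc p (r ⊗ s) k ⟨
  (p ⊗ (r ⊗ s)) (suc k) ∎
  where
  open ≡-Reasoning
  p₀r₀ = p 0 * r 0

⊗-zeroˡ : ∀ p → (zeroP ⊗ p) ≈P zeroP
⊗-zeroˡ p k = trans (sum-cong k (λ a _ → ℤP.*-zeroˡ (p (k ∸ a)))) (sum-zero k)

⊗-zeroʳ : ∀ p → (p ⊗ zeroP) ≈P zeroP
⊗-zeroʳ p = ≈P-trans (⊗-comm p zeroP) (⊗-zeroˡ p)

⊗-identityˡ : ∀ p → (oneP ⊗ p) ≈P p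
⊗-identityˡ p zero    = ℤP.*-identityˡ (p 0)
⊗-identityˡ p (suc k) = trans (⊗-suc oneP p k)
  (trans (cong₂ _+_ (ℤP.*-identityˡ (p (suc k))) (⊗-zeroˡ p k)) (ℤP.+-identityʳ _))

⊗-identityʳ : ∀ p → (p ⊗ oneP) ≈P p
⊗-identityʳ p = ≈P-trans (⊗-comm p oneP) (⊗-identityˡ p)

negP : Poly → Poly
negP p k = - p k

polyIsCommutativeRing : IsCommutativeRing _≈P_ _⊕_ _⊗_ negP zeroP oneP
polyIsCommutativeRing = record
  { isRing = record
    { +-isAbelianGroup = record
      { isGroup = record
        { isMonoid = record
          { isSemigroup = record
            { isMagma = record { isEquivalence = ≈P-isEquivalence ; ∙-cong = ⊕-cong }
            ; assoc   = λ p r s k → ℤP.+-assoc (p k) (r k) (s k) }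
          ; identity = (λ p k → ℤP.+-identityˡ (p k)) , (λ p k → ℤP.+-identityʳ (p k)) }
        ; inverse = (λ p k → ℤP.+-inverseˡ (p k)) , (λ p k → ℤP.+-inverseʳ (p k))
        ; ⁻¹-cong = λ p≈r k → cong -_ (p≈r k) }
      ; comm = λ p r k → ℤP.+-comm (p k) (r k) }
    ; *-cong     = ⊗-cong
    ; *-assoc    = ⊗-assoc
    ; *-identity = ⊗-identityˡ , ⊗-identityʳ
    ; distrib    = ⊗-distribˡ , ⊗-distribʳ }
  ; *-comm = ⊗-comm }

polyCommutativeRing : CommutativeRing _ _
polyCommutativeRing = record { isCommutativeRing = polyIsCommutativeRing }

⊕-interchange : ∀ a b c d → ((a ⊕ b) ⊕ (c ⊕ d)) ≈P ((a ⊕ c) ⊕ (b ⊕ d))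
⊕-interchange = CommSemigroupProperties.interchange
  (CommutativeRing.+-commutativeSemigroup polyCommutativeRing)

-- Constant polynomials; ℤ embeds into the polynomial ring, which instantiates the ring solver.

constP : ℤ → Poly
constP c zero    = c
constP c (suc _) = + 0

constP-+ : ∀ a b → constP (a + b) ≈P (constP a ⊕ constP b)
constP-+ a b zero    = refl
constP-+ a b (suc k) = refl

constP-* : ∀ a b → constP (a * b) ≈P (constP a ⊗ constP b)
constP-* a b zero    = refl
constP-* a b (suc k) = sym (trans (⊗-suc (constP a) (constP b) k)
  (cong₂ _+_ (ℤP.*-zeroʳ a) (⊗-zeroˡ (constP b) k)))

constP-neg : ∀ a → constP (- a) ≈P negP (constP a)
constP-neg a zero    = refl
constP-neg a (suc k) = refl

constP-0 : constP (+ 0) ≈P zeroP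
constP-0 zero    = refl
constP-0 (suc k) = refl

constP-1 : constP (+ 1) ≈P oneP
constP-1 zero    = refl
constP-1 (suc k) = refl

scale-constP : ∀ c p → scale c p ≈P (constP c ⊗ p)
scale-constP c p zero    = refl
scale-constP c p (suc k) = sym (trans (⊗-suc (constP c) p k)
  (trans (cong (_+_ (c * p (suc k))) (⊗-zeroˡ p k)) (ℤP.+-identityʳ _)))

constP-morphism : CommutativeRing.rawRing ℤP.+-*-commutativeRing
                    ACR.-Raw-AlmostCommutative⟶ ACR.fromCommutativeRing polyCommutativeRing
constP-morphism = record
  { ⟦_⟧    = constP
  ; +-homo = constP-+
  ; *-homo = constP-*
  ; -‿homo = constP-neg
  ; 0-homo = constP-0
  ; 1-homo = constP-1 }

constP-≟ : ∀ x y → Maybe (constP x ≈P constP y)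
constP-≟ x y with x ℤ.≟ y
... | yes refl = just ≈P-refl
... | no _     = nothing

open import Algebra.Solver.Ring _ _ constP-morphism constP-≟
  using (solve; _:+_; _:*_; :-_; _:=_; con)

mulq : Poly → Poly
mulq p zero    = + 0
mulq p (suc k) = p k

X^-suc-suc : ∀ a j → X^ (suc a) (suc j) ≡ X^ a j
X^-suc-suc a j with j ℕ.≟ a | suc j ℕ.≟ suc a
... | yes _   | yes _   = refl
... | no _    | no _    = refl
... | yes j≡a | no j≢a  = ⊥-elim (j≢a (cong suc j≡a))
... | no j≢a  | yes j≡a = ⊥-elim (j≢a (ℕP.suc-injective j≡a))

X^-zero : X^ 0 ≈P oneP
X^-zero zero    = refl
X^-zero (suc k) = refl

X^-suc : ∀ a → X^ (suc a) ≈P mulq (X^ a)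
X^-suc a zero    = refl
X^-suc a (suc k) = X^-suc-suc a k

X^-suc-⊗ : ∀ a p → (X^ (suc a) ⊗ p) ≈P mulq (X^ a ⊗ p)
X^-suc-⊗ a p zero    = ℤP.*-zeroˡ (p 0)
X^-suc-⊗ a p (suc k) = trans (⊗-suc (X^ (suc a)) p k)
  (trans (cong₂ _+_ (ℤP.*-zeroˡ (p (suc k))) (⊗-congʳ p (X^-suc-suc a) k)) (ℤP.+-identityˡ _))

X^-+ : ∀ a b → X^ (a ℕ.+ b) ≈P (X^ a ⊗ X^ b)
X^-+ zero    b = ≈P-sym (≈P-trans (⊗-congʳ (X^ b) X^-zero) (⊗-identityˡ (X^ b)))
X^-+ (suc a) b = ≈P-trans (X^-suc (a ℕ.+ b))
  (≈P-trans (λ { zero → refl ; (suc k) → X^-+ a b k }) (≈P-sym (X^-suc-⊗ a (X^ b))))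

^P-+ : ∀ p a b → (p ^P (a ℕ.+ b)) ≈P ((p ^P a) ⊗ (p ^P b))
^P-+ p zero    b = ≈P-sym (⊗-identityˡ (p ^P b))
^P-+ p (suc a) b = ≈P-trans (⊗-congˡ p (^P-+ p a b)) (≈P-sym (⊗-assoc p (p ^P a) (p ^P b)))

sign : ℕ → ℤ
sign a = (- + 1) ^ a

signedTerm : ℕ → ℕ → Poly
signedTerm a e = scale (sign a) (X^ a ⊗ (onePlusQ ^P e))

signedTerm-congʳ : ∀ a {e e'} → e ≡ e' → signedTerm a e ≈P signedTerm a e'
signedTerm-congʳ a refl = ≈P-refl

signedTerm-⊗ : ∀ a e b f → (signedTerm a e ⊗ signedTerm b f) ≈P signedTerm (a ℕ.+ b) (e ℕ.+ f)
signedTerm-⊗ a e b f = begin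
  (signedTerm a e ⊗ signedTerm b f)
    ≈⟨ ⊗-cong (scale-constP (sign a) (X^ a ⊗ (onePlusQ ^P e))) (scale-constP (sign b) (X^ b ⊗ (onePlusQ ^P f))) ⟩
  ((sa ⊗ (X^ a ⊗ (onePlusQ ^P e))) ⊗ (sb ⊗ (X^ b ⊗ (onePlusQ ^P f))))
    ≈⟨ solve 6 (λ ca cb xa xb ea eb → (ca :* (xa :* ea)) :* (cb :* (xb :* eb))
                                   := (ca :* cb) :* ((xa :* xb) :* (ea :* eb)))
             ≈P-refl sa sb (X^ a) (X^ b) (onePlusQ ^P e) (onePlusQ ^P f) ⟩
  ((sa ⊗ sb) ⊗ ((X^ a ⊗ X^ b) ⊗ ((onePlusQ ^P e) ⊗ (onePlusQ ^P f))))
    ≈⟨ ⊗-cong sign-+ (⊗-cong (≈P-sym (X^-+ a b)) (≈P-sym (^P-+ onePlusQ e f))) ⟩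
  (constP (sign (a ℕ.+ b)) ⊗ (X^ (a ℕ.+ b) ⊗ (onePlusQ ^P (e ℕ.+ f))))
    ≈⟨ scale-constP (sign (a ℕ.+ b)) (X^ (a ℕ.+ b) ⊗ (onePlusQ ^P (e ℕ.+ f))) ⟨
  signedTerm (a ℕ.+ b) (e ℕ.+ f) ∎
  where
  open SetoidReasoning polySetoid
  sa = constP (sign a)
  sb = constP (sign b)
  sign-+ : (sa ⊗ sb) ≈P constP (sign (a ℕ.+ b))
  sign-+ = ≈P-trans (≈P-sym (constP-* (sign a) (sign b)))
                    (λ k → cong (λ c → constP c k) (sym (ℤP.^-distribˡ-+-* (- + 1) a b)))

-- The step weights 1, 1+q, -q of the transfer matrix are signed basis polynomials.
signedTerm-0-0 : signedTerm 0 0 ≈P oneP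
signedTerm-0-0 k = trans (ℤP.*-identityˡ _) (trans (⊗-identityʳ (X^ 0) k) (X^-zero k))

signedTerm-0-1 : signedTerm 0 1 ≈P onePlusQ
signedTerm-0-1 k = trans (ℤP.*-identityˡ _)
  (trans (⊗-cong X^-zero (⊗-identityʳ onePlusQ) k) (⊗-identityˡ onePlusQ k))

signedTerm-1-0 : signedTerm 1 0 ≈P negP (X^ 1)
signedTerm-1-0 k = trans (sym (ℤP.neg-distribˡ-* (+ 1) ((X^ 1 ⊗ oneP) k)))
  (cong -_ (trans (ℤP.*-identityˡ _) (⊗-identityʳ (X^ 1) k)))

sumList : {A : Set} → List A → (A → Poly) → Poly
sumList []       g = zeroP
sumList (x ∷ xs) g = g x ⊕ sumList xs g

sumList-cong : {A : Set} (xs : List A) {g h : A → Poly} →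
               (∀ x → x ∈ xs → g x ≈P h x) → sumList xs g ≈P sumList xs h
sumList-cong []       g≈h = ≈P-refl
sumList-cong (x ∷ xs) g≈h = ⊕-cong (g≈h x (here refl)) (sumList-cong xs (λ y y∈ → g≈h y (there y∈)))

sumList-++ : {A : Set} (xs ys : List A) (g : A → Poly) →
             sumList (xs ++ ys) g ≈P (sumList xs g ⊕ sumList ys g)
sumList-++ []       ys g k = sym (ℤP.+-identityˡ _)
sumList-++ (x ∷ xs) ys g   = ≈P-trans (⊕-congˡ (g x) (sumList-++ xs ys g))
                                      (λ k → sym (ℤP.+-assoc (g x k) _ _))

sumList-concatMap : {A B : Set} (h : A → List B) (xs : List A) (g : B → Poly) →
                    sumList (concatMap h xs) g ≈P sumList xs (λ x → sumList (h x) g)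
sumList-concatMap h []       g = ≈P-refl
sumList-concatMap h (x ∷ xs) g = ≈P-trans (sumList-++ (h x) (concatMap h xs) g)
                                          (⊕-congˡ (sumList (h x) g) (sumList-concatMap h xs g))

sumList-map : {A B : Set} (h : A → B) (xs : List A) (g : B → Poly) →
              sumList (map h xs) g ≈P sumList xs (λ x → g (h x))
sumList-map h []       g = ≈P-refl
sumList-map h (x ∷ xs) g = ⊕-congˡ (g (h x)) (sumList-map h xs g)

sumList-⊕ : {A : Set} (xs : List A) (g h : A → Poly) →
            sumList xs (λ x → g x ⊕ h x) ≈P (sumList xs g ⊕ sumList xs h)
sumList-⊕ []       g h k = sym (ℤP.+-identityˡ (+ 0))
sumList-⊕ (x ∷ xs) g h   = ≈P-trans (⊕-congˡ (g x ⊕ h x) (sumList-⊕ xs g h))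
                                    (⊕-interchange (g x) (h x) (sumList xs g) (sumList xs h))

sumList-⊗ : {A : Set} (c : Poly) (xs : List A) (g : A → Poly) →
            (c ⊗ sumList xs g) ≈P sumList xs (λ x → c ⊗ g x)
sumList-⊗ c []       g = ⊗-zeroʳ c
sumList-⊗ c (x ∷ xs) g = ≈P-trans (⊗-distribˡ c (g x) (sumList xs g)) (⊕-congˡ (c ⊗ g x) (sumList-⊗ c xs g))

sumList-filter : {A : Set} (P : A → Bool) (xs : List A) (g : A → Poly) →
                 sumList (filterᵇ P xs) g ≈P sumList xs (λ x → if P x then g x else zeroP)
sumList-filter P []       g = ≈P-refl
sumList-filter P (x ∷ xs) g with P x
... | true  = ⊕-congˡ (g x) (sumList-filter P xs g)
... | false = λ k → trans (sumList-filter P xs g k) (sym (ℤP.+-identityˡ _))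

sumFin : ∀ N → (Fin N → Poly) → Poly
sumFin zero    G = zeroP
sumFin (suc N) G = G zero ⊕ sumFin N (λ i → G (suc i))

foldr-allFin : ∀ N (G : Fin N → Poly) → foldr _⊕_ zeroP (map G (allFin N)) ≡ sumFin N G
foldr-allFin N G = trans (cong (foldr _⊕_ zeroP) (ListP.map-tabulate id G)) (foldr-tabulate N G)
  where
  foldr-tabulate : ∀ N (G : Fin N → Poly) → foldr _⊕_ zeroP (tabulate G) ≡ sumFin N G
  foldr-tabulate zero    G = refl
  foldr-tabulate (suc N) G = cong (G zero ⊕_) (foldr-tabulate N (λ i → G (suc i)))

sumFin-cong : ∀ N {G H : Fin N → Poly} → (∀ i → G i ≈P H i) → sumFin N G ≈P sumFin N H
sumFin-cong zero    G≈H = ≈P-refl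
sumFin-cong (suc N) G≈H = ⊕-cong (G≈H zero) (sumFin-cong N (λ i → G≈H (suc i)))

sumFin-zero : ∀ N {G : Fin N → Poly} → (∀ i → G i ≈P zeroP) → sumFin N G ≈P zeroP
sumFin-zero zero    G≈0 = ≈P-refl
sumFin-zero (suc N) G≈0 = ⊕-cong (G≈0 zero) (sumFin-zero N (λ i → G≈0 (suc i)))

sumFin-⊕ : ∀ N (G H : Fin N → Poly) → sumFin N (λ i → G i ⊕ H i) ≈P (sumFin N G ⊕ sumFin N H)
sumFin-⊕ zero    G H k = refl
sumFin-⊕ (suc N) G H   = ≈P-trans (⊕-congˡ (G zero ⊕ H zero) (sumFin-⊕ N _ _))
  (⊕-interchange (G zero) (H zero) (sumFin N (λ i → G (suc i))) (sumFin N (λ i → H (suc i))))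

sumFin-neg : ∀ N (G : Fin N → Poly) → sumFin N (λ i → negP (G i)) ≈P negP (sumFin N G)
sumFin-neg zero    G k = refl
sumFin-neg (suc N) G k = trans (cong (_+_ (- G zero k)) (sumFin-neg N (λ i → G (suc i)) k))
                               (sym (ℤP.neg-distrib-+ (G zero k) _))

countBy : {A : Set} → (A → ℕ) → List A → ℕ → ℕ
countBy E T i = length (filterᵇ (λ t → ⌊ E t ℕ.≟ i ⌋) T)

-- The Kronecker delta, as the coefficient of q^i in q^a.
δ : ℕ → ℕ → ℤ
δ a i = X^ i a

countBy-∷ : {A : Set} (E : A → ℕ) (t : A) (T : List A) (i : ℕ) →
            + countBy E (t ∷ T) i ≡ δ (E t) i + + countBy E T i
countBy-∷ E t T i with E t ℕ.≟ i
... | yes _ = refl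
... | no _  = sym (ℤP.+-identityˡ _)

sumFin-δ : ∀ N a (H : ℕ → Poly) → a < N → sumFin N (λ i → scale (δ a (toℕ i)) (H (toℕ i))) ≈P H a
sumFin-δ (suc N) zero H _ k = trans
  (cong₂ _+_ (ℤP.*-identityˡ (H 0 k)) (sumFin-zero N (λ i k' → ℤP.*-zeroˡ (H (suc (toℕ i)) k')) k))
  (ℤP.+-identityʳ (H 0 k))
sumFin-δ (suc N) (suc a) H (s≤s a<N) k = trans
  (cong₂ _+_ (ℤP.*-zeroˡ (H 0 k))
             (sumFin-cong N (λ i k' → cong (λ c → c * H (suc (toℕ i)) k') (X^-suc-suc (toℕ i) a)) k))
  (trans (ℤP.+-identityˡ _) (sumFin-δ N a (λ j → H (suc j)) a<N k))

sumList-groupBy : {A : Set} (E : A → ℕ) (F : ℕ → Poly) (N : ℕ) (T : List A) → (∀ t → t ∈ T → E t ≤ N) →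
  sumList T (λ t → F (E t)) ≈P sumFin (suc N) (λ i → scale (+ countBy E T (toℕ i)) (F (toℕ i)))
sumList-groupBy E F N [] _ = ≈P-sym (sumFin-zero (suc N) (λ i k → ℤP.*-zeroˡ (F (toℕ i) k)))
sumList-groupBy E F N (t ∷ T) E≤N = ≈P-sym (begin
  sumFin (suc N) (λ i → scale (+ countBy E (t ∷ T) (toℕ i)) (F (toℕ i)))
    ≈⟨ sumFin-cong (suc N) (λ i k → trans (cong (λ c → c * F (toℕ i) k) (countBy-∷ E t T (toℕ i)))
                                           (ℤP.*-distribʳ-+ (F (toℕ i) k) (δ (E t) (toℕ i)) _)) ⟩
  sumFin (suc N) (λ i → scale (δ (E t) (toℕ i)) (F (toℕ i)) ⊕ scale (+ countBy E T (toℕ i)) (F (toℕ i)))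
    ≈⟨ sumFin-⊕ (suc N) (λ i → scale (δ (E t) (toℕ i)) (F (toℕ i)))
                        (λ i → scale (+ countBy E T (toℕ i)) (F (toℕ i))) ⟩
  (sumFin (suc N) (λ i → scale (δ (E t) (toℕ i)) (F (toℕ i)))
    ⊕ sumFin (suc N) (λ i → scale (+ countBy E T (toℕ i)) (F (toℕ i))))
    ≈⟨ ⊕-cong (sumFin-δ (suc N) (E t) F (s≤s (E≤N t (here refl))))
              (≈P-sym (sumList-groupBy E F N T (λ t' t'∈ → E≤N t' (there t'∈)))) ⟩
  (F (E t) ⊕ sumList T (λ t → F (E t))) ∎)
  where open SetoidReasoning polySetoid

-- A bit is true when the corresponding edge is chosen.  The weight of two consecutive
-- bits a b records whether an edge is being "opened" (-q), "closed" (1) or is absent at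
-- both (1+q); two consecutive chosen edges get weight 0.
stepWeight : Bool → Bool → Poly
stepWeight false false = onePlusQ
stepWeight false true  = negP (X^ 1)
stepWeight true  false = oneP
stepWeight true  true  = zeroP

pathWeight : Bool → ∀ {k} → Vec Bool k → Bool → Poly
pathWeight p []      f = stepWeight p f
pathWeight p (t ∷ T) f = stepWeight p t ⊗ pathWeight t T f

noAdjacentᵇ : Bool → ∀ {k} → Vec Bool k → Bool → Bool
noAdjacentᵇ p []      f = not (p ∧ f)
noAdjacentᵇ p (t ∷ T) f = not (p ∧ t) ∧ noAdjacentᵇ t T f

-- On words without adjacent trues, the path weight is a signed basis polynomial:
-- of the k+1 steps, ∣ T ∷ʳ f ∣ enter a true (weight -q), ∣ p ∷ T ∣ leave one (weight 1),
-- and the remaining e go from false to false (weight 1+q).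
pathWeight-noAdjacent : ∀ p {k} (T : Vec Bool k) f → noAdjacentᵇ p T f ≡ true →
  Σ ℕ λ e → (e ℕ.+ ∣ T ∷ʳ f ∣ ℕ.+ ∣ p ∷ T ∣ ≡ suc k) × (pathWeight p T f ≈P signedTerm ∣ T ∷ʳ f ∣ e)
pathWeight-noAdjacent false []          false _ = 1 , refl , ≈P-sym signedTerm-0-1
pathWeight-noAdjacent false []          true  _ = 0 , refl , ≈P-sym signedTerm-1-0
pathWeight-noAdjacent true  []          false _ = 0 , refl , ≈P-sym signedTerm-0-0
pathWeight-noAdjacent false (false ∷ T) f   ok with pathWeight-noAdjacent false T f ok
... | e , steps , w≈ = suc e , cong suc steps ,
  ≈P-trans (⊗-cong (≈P-sym signedTerm-0-1) w≈) (signedTerm-⊗ 0 1 ∣ T ∷ʳ f ∣ e)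
pathWeight-noAdjacent false (true ∷ T)  f   ok with pathWeight-noAdjacent true T f ok
... | e , steps , w≈ = e , trans (cong (ℕ._+ ∣ true ∷ T ∣) (ℕP.+-suc e _)) (cong suc steps) ,
  ≈P-trans (⊗-cong (≈P-sym signedTerm-1-0) w≈) (signedTerm-⊗ 1 0 ∣ T ∷ʳ f ∣ e)
pathWeight-noAdjacent true  (false ∷ T) f   ok with pathWeight-noAdjacent false T f ok
... | e , steps , w≈ = e , trans (ℕP.+-suc (e ℕ.+ ∣ T ∷ʳ f ∣) _) (cong suc steps) ,
  ≈P-trans (⊗-cong (≈P-sym signedTerm-0-0) w≈) (signedTerm-⊗ 0 0 ∣ T ∷ʳ f ∣ e)

pathWeight-adjacent : ∀ p {k} (T : Vec Bool k) f → noAdjacentᵇ p T f ≡ false → pathWeight p T f ≈P zeroP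
pathWeight-adjacent true  []          true  _   = ≈P-refl
pathWeight-adjacent false (t ∷ T)     f     adj =
  ≈P-trans (⊗-congˡ (stepWeight false t) (pathWeight-adjacent t T f adj)) (⊗-zeroʳ (stepWeight false t))
pathWeight-adjacent true  (false ∷ T) f     adj =
  ≈P-trans (⊗-congˡ oneP (pathWeight-adjacent false T f adj)) (⊗-identityˡ zeroP)
pathWeight-adjacent true  (true ∷ T)  f     _   = ⊗-zeroˡ (pathWeight true T f)

-- transfer k p f = Σ_{T ∈ {0,1}^k} pathWeight p T f is the (p,f) entry of the k+1-st power
-- of the 2×2 matrix of step weights.
transfer : ℕ → Bool → Bool → Poly
transfer k p f = sumList (allSubsets k) (λ T → pathWeight p T f)

sumList-allSubsets : ∀ k (g : Vec Bool (suc k) → Poly) →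
  sumList (allSubsets (suc k)) g ≈P sumList (allSubsets k) (λ T → g (false ∷ T) ⊕ g (true ∷ T))
sumList-allSubsets k g = ≈P-trans (sumList-concatMap (λ S → (false ∷ S) ∷ (true ∷ S) ∷ []) (allSubsets k) g)
  (sumList-cong (allSubsets k) (λ T _ → ⊕-congˡ (g (false ∷ T)) (λ j → ℤP.+-identityʳ (g (true ∷ T) j))))

transfer-zero : ∀ p f → transfer 0 p f ≈P stepWeight p f
transfer-zero p f k = ℤP.+-identityʳ (stepWeight p f k)

transfer-suc : ∀ k p f →
  transfer (suc k) p f ≈P ((stepWeight p false ⊗ transfer k false f) ⊕ (stepWeight p true ⊗ transfer k true f))
transfer-suc k p f = ≈P-trans (sumList-allSubsets k (λ T → pathWeight p T f))
  (≈P-trans (sumList-⊕ (allSubsets k) _ _)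
            (⊕-cong (≈P-sym (sumList-⊗ (stepWeight p false) (allSubsets k) _))
                    (≈P-sym (sumList-⊗ (stepWeight p true) (allSubsets k) _))))

-- The row of a chosen edge: its successor is not chosen (weight 1).
transfer-suc-true : ∀ k f → transfer (suc k) true f ≈P transfer k false f
transfer-suc-true k f = ≈P-trans (transfer-suc k true f)
  (≈P-trans (⊕-cong (⊗-identityˡ (transfer k false f)) (⊗-zeroˡ (transfer k true f)))
            (λ j → ℤP.+-identityʳ (transfer k false f j)))

-- The trace of the transfer matrix: the weighted count of cyclic words.
trace : ℕ → Poly
trace k = transfer k false false ⊕ transfer k true true

ObeysRecurrence : (ℕ → Poly) → Set
ObeysRecurrence x = ∀ k → x (suc (suc k)) ≈P ((onePlusQ ⊗ x (suc k)) ⊕ (negP (X^ 1) ⊗ x k))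

recurrence-unique : ∀ {x y} → ObeysRecurrence x → ObeysRecurrence y →
  x 0 ≈P y 0 → x 1 ≈P y 1 → ∀ k → x k ≈P y k
recurrence-unique {x} {y} rx ry x₀ x₁ k = proj₁ (both k)
  where
  both : ∀ k → (x k ≈P y k) × (x (suc k) ≈P y (suc k))
  both zero    = x₀ , x₁
  both (suc k) with both k
  ... | xk , xk₁ = xk₁ , ≈P-trans (rx k) (≈P-trans
         (⊕-cong (⊗-congˡ onePlusQ xk₁) (⊗-congˡ (negP (X^ 1)) xk)) (≈P-sym (ry k)))

-- The trace obeys the recurrence (Cayley–Hamilton for the transfer matrix).
trace-recurrence : ObeysRecurrence trace
trace-recurrence k = begin
  trace (suc (suc k))
    ≈⟨ ⊕-cong (≈P-trans (transfer-suc (suc k) false false)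
                        (⊕-congˡ (onePlusQ ⊗ a) (⊗-congˡ (negP q) (transfer-suc-true k false))))
              (≈P-trans (transfer-suc-true (suc k) true) (transfer-suc k false true)) ⟩
  (((onePlusQ ⊗ a) ⊕ (negP q ⊗ b)) ⊕ ((onePlusQ ⊗ c) ⊕ (negP q ⊗ d)))
    ≈⟨ solve 6 (λ u qq a b c d → ((u :* a) :+ ((:- qq) :* b)) :+ ((u :* c) :+ ((:- qq) :* d))
                             := (u :* (a :+ c)) :+ ((:- qq) :* (b :+ d)))
             ≈P-refl onePlusQ q a b c d ⟩
  ((onePlusQ ⊗ (a ⊕ c)) ⊕ (negP q ⊗ (b ⊕ d)))
    ≈⟨ ⊕-congʳ (negP q ⊗ trace k) (⊗-congˡ onePlusQ (⊕-congˡ a (≈P-sym (transfer-suc-true k true)))) ⟩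
  ((onePlusQ ⊗ trace (suc k)) ⊕ (negP q ⊗ trace k)) ∎
  where
  open SetoidReasoning polySetoid
  q = X^ 1
  a = transfer (suc k) false false
  b = transfer k false false
  c = transfer k false true
  d = transfer k true true

cyclePoly : ℕ → Poly
cyclePoly k = oneP ⊕ X^ (suc k)

cyclePoly-recurrence : ObeysRecurrence cyclePoly
cyclePoly-recurrence k = begin
  (oneP ⊕ X^ (3 ℕ.+ k))
    ≈⟨ ⊕-cong (≈P-sym constP-1) (≈P-trans (X^-+ 1 (2 ℕ.+ k)) (⊗-congˡ q (X^-+ 1 (suc k)))) ⟩
  (constP (+ 1) ⊕ (q ⊗ (q ⊗ y)))
    ≈⟨ solve 2 (λ qq yy → con (+ 1) :+ (qq :* (qq :* yy))
                      := ((con (+ 1) :+ qq) :* (con (+ 1) :+ (qq :* yy))) :+ ((:- qq) :* (con (+ 1) :+ yy)))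
             ≈P-refl q y ⟩
  (((constP (+ 1) ⊕ q) ⊗ (constP (+ 1) ⊕ (q ⊗ y))) ⊕ (negP q ⊗ (constP (+ 1) ⊕ y)))
    ≈⟨ ⊕-cong (⊗-cong (⊕-congʳ q constP-1) (⊕-cong constP-1 (≈P-sym (X^-+ 1 (suc k)))))
              (⊗-congˡ (negP q) (⊕-congʳ y constP-1)) ⟩
  ((onePlusQ ⊗ cyclePoly (suc k)) ⊕ (negP q ⊗ cyclePoly k)) ∎
  where
  open SetoidReasoning polySetoid
  q = X^ 1
  y = X^ (suc k)

trace≈cyclePoly : ∀ k → trace k ≈P cyclePoly k
trace≈cyclePoly = recurrence-unique trace-recurrence cyclePoly-recurrence trace-0 trace-1
  where
  open SetoidReasoning polySetoid
  q = X^ 1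
  trace-0 : trace 0 ≈P cyclePoly 0
  trace-0 k = trans (cong₂ _+_ (transfer-zero false false k) (transfer-zero true true k)) (ℤP.+-identityʳ _)
  trace-1 : trace 1 ≈P cyclePoly 1
  trace-1 = begin
    trace 1
      ≈⟨ ⊕-cong (≈P-trans (transfer-suc 0 false false)
                          (⊕-cong (⊗-congˡ onePlusQ (transfer-zero false false))
                                  (⊗-congˡ (negP q) (transfer-zero true false))))
                (≈P-trans (transfer-suc-true 0 true) (transfer-zero false true)) ⟩
    (((onePlusQ ⊗ onePlusQ) ⊕ (negP q ⊗ oneP)) ⊕ negP q)
      ≈⟨ ⊕-congʳ (negP q) (⊕-cong (⊗-cong one+q one+q) (⊗-congˡ (negP q) (≈P-sym constP-1))) ⟩
    ((((constP (+ 1) ⊕ q) ⊗ (constP (+ 1) ⊕ q)) ⊕ (negP q ⊗ constP (+ 1))) ⊕ negP q)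
      ≈⟨ solve 1 (λ qq → (((con (+ 1) :+ qq) :* (con (+ 1) :+ qq)) :+ ((:- qq) :* con (+ 1))) :+ (:- qq)
                      := con (+ 1) :+ (qq :* qq)) ≈P-refl q ⟩
    (constP (+ 1) ⊕ (q ⊗ q))
      ≈⟨ ⊕-cong constP-1 (≈P-sym (X^-+ 1 1)) ⟩
    cyclePoly 1 ∎
    where
    one+q : onePlusQ ≈P (constP (+ 1) ⊕ q)
    one+q = ⊕-congʳ q (≈P-sym constP-1)

∧-split : ∀ {a b} → (a ∧ b) ≡ true → (a ≡ true) × (b ≡ true)
∧-split {true} {true} refl = refl , refl

∧-false-intro : ∀ {a b} → (a ≡ true → b ≡ true → ⊥) → (a ∧ b) ≡ false
∧-false-intro {false} {_}     _   = refl
∧-false-intro {true}  {false} _   = refl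
∧-false-intro {true}  {true}  ¬ab = ⊥-elim (¬ab refl refl)

≡-true-ext : ∀ {a b} → (a ≡ true → b ≡ true) → (b ≡ true → a ≡ true) → a ≡ b
≡-true-ext {false} {false} _ _ = refl
≡-true-ext {false} {true}  _ g = g refl
≡-true-ext {true}  {false} f _ = sym (f refl)
≡-true-ext {true}  {true}  _ _ = refl

≠ᵇ-true : ∀ {m} {e f : Fin m} → e ≢ f → (e ≠ᵇ f) ≡ true
≠ᵇ-true {e = e} {f} e≢f with e Fin.≟ f
... | yes e≡f = ⊥-elim (e≢f e≡f)
... | no _    = refl

≠ᵇ-refl : ∀ {m} (e : Fin m) → (e ≠ᵇ e) ≡ false
≠ᵇ-refl e with e Fin.≟ e
... | yes _  = refl
... | no e≢e = ⊥-elim (e≢e refl)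

allᵇ-intro : {A : Set} (p : A → Bool) (xs : List A) → (∀ x → p x ≡ true) → allᵇ p xs ≡ true
allᵇ-intro p []       _   = refl
allᵇ-intro p (x ∷ xs) all = cong₂ _∧_ (all x) (allᵇ-intro p xs all)

allᵇ-elim : {A : Set} (p : A → Bool) (xs : List A) → allᵇ p xs ≡ true → ∀ x → x ∈ xs → p x ≡ true
allᵇ-elim p (y ∷ xs) ok x (here refl) = proj₁ (∧-split ok)
allᵇ-elim p (y ∷ xs) ok x (there x∈)  = allᵇ-elim p xs (proj₂ (∧-split {p y} ok)) x x∈

LastOrInject : ∀ {k} → Fin (suc k) → Set
LastOrInject {k} e = (e ≡ fromℕ k) ⊎ (Σ (Fin k) λ i → e ≡ inject₁ i)

lastOrInject : ∀ {k} (e : Fin (suc k)) → LastOrInject e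
lastOrInject {zero}  zero    = inj₁ refl
lastOrInject {suc k} zero    = inj₂ (zero , refl)
lastOrInject {suc k} (suc e) with lastOrInject e
... | inj₁ e≡last    = inj₁ (cong suc e≡last)
... | inj₂ (i , e≡i) = inj₂ (suc i , cong suc e≡i)

tgt-last : ∀ k → tgt (fromℕ k) ≡ zero
tgt-last k = FinP.toℕ-injective (trans (FinP.toℕ-fromℕ< _)
  (trans (cong (λ x → suc x ℕD.% suc k) (FinP.toℕ-fromℕ k)) (ℕD.n%n≡0 (suc k))))

tgt-inject₁ : ∀ {k} (i : Fin k) → tgt (inject₁ i) ≡ suc i
tgt-inject₁ {k} i = FinP.toℕ-injective (trans (FinP.toℕ-fromℕ< _)
  (trans (cong (λ x → suc x ℕD.% suc k) (FinP.toℕ-inject₁ i)) (ℕD.m<n⇒m%n≡m (ℕ.s≤s (FinP.toℕ<n i)))))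

tgt-injective : ∀ {m} {e f : Fin m} → tgt e ≡ tgt f → e ≡ f
tgt-injective {suc k} {e} {f} eq with lastOrInject e | lastOrInject f
... | inj₁ refl       | inj₁ refl       = refl
... | inj₁ refl       | inj₂ (j , refl) with () ← trans (sym (tgt-last k)) (trans eq (tgt-inject₁ j))
... | inj₂ (i , refl) | inj₁ refl       with () ← trans (sym (tgt-inject₁ i)) (trans eq (tgt-last k))
... | inj₂ (i , refl) | inj₂ (j , refl) =
  cong inject₁ (FinP.suc-injective (trans (sym (tgt-inject₁ i)) (trans eq (tgt-inject₁ j))))

-- Rotating the word s t₁ … t_k to t₁ … t_k s: the successor of edge e in S is edge e of the rotation.
lookup-tgt : ∀ {k} (s : Bool) (T : Vec Bool k) (e : Fin (suc k)) → lookup (s ∷ T) (tgt e) ≡ lookup (T ∷ʳ s) e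
lookup-tgt {k} s T e with lastOrInject e
... | inj₁ refl       = trans (cong (lookup (s ∷ T)) (tgt-last k)) (sym (lookup-last T))
  where
  lookup-last : ∀ {k} (T : Vec Bool k) → lookup (T ∷ʳ s) (fromℕ k) ≡ s
  lookup-last []      = refl
  lookup-last (t ∷ T) = lookup-last T
... | inj₂ (i , refl) = trans (cong (lookup (s ∷ T)) (tgt-inject₁ i)) (sym (lookup-inject₁ T i))
  where
  lookup-inject₁ : ∀ {k} (T : Vec Bool k) (i : Fin k) → lookup (T ∷ʳ s) (inject₁ i) ≡ lookup T i
  lookup-inject₁ (t ∷ T) zero    = refl
  lookup-inject₁ (t ∷ T) (suc i) = lookup-inject₁ T i

NoConsecutive : ∀ {m} → Subset m → Set
NoConsecutive {m} S = ∀ (e : Fin m) → (lookup S e ∧ lookup S (tgt e)) ≡ false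

partnersOKᵇ : ∀ {m} → Subset m → Fin m → Bool
partnersOKᵇ {m} S e = allᵇ (λ f → not (lookup S f) ∨ ⌊ e Fin.≟ f ⌋ ∨ disjointᵇ e f) (allFin m)

isMatching-at : ∀ {m} (S : Subset m) → isMatching m S ≡ true → ∀ e → lookup S e ≡ true →
  (not (isLoop e) ≡ true) × (∀ f → lookup S f ≡ true → (⌊ e Fin.≟ f ⌋ ∨ disjointᵇ e f) ≡ true)
isMatching-at {m} S ok e Se = proj₁ (∧-split conditions) , partners
  where
  conditions : (not (isLoop e) ∧ partnersOKᵇ S e) ≡ true
  conditions = subst (λ b → (not b ∨ (not (isLoop e) ∧ partnersOKᵇ S e)) ≡ true) Se (allᵇ-elim _ (allFin m) ok e (∈-allFin e))
  partners : ∀ f → lookup S f ≡ true → (⌊ e Fin.≟ f ⌋ ∨ disjointᵇ e f) ≡ true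
  partners f Sf = subst (λ b → (not b ∨ ⌊ e Fin.≟ f ⌋ ∨ disjointᵇ e f) ≡ true) Sf
    (allᵇ-elim _ (allFin m) (proj₂ (∧-split {not (isLoop e)} conditions)) f (∈-allFin f))

disjointᵇ-tgt : ∀ {m} (e : Fin m) → disjointᵇ e (tgt e) ≡ false
disjointᵇ-tgt e rewrite ≠ᵇ-refl (tgt e) =
  trans (cong ((e ≠ᵇ tgt e) ∧_) (BoolP.∧-zeroʳ (e ≠ᵇ tgt (tgt e)))) (BoolP.∧-zeroʳ (e ≠ᵇ tgt e))

isMatching⇒noConsecutive : ∀ {m} (S : Subset m) → isMatching m S ≡ true → NoConsecutive S
isMatching⇒noConsecutive S ok e = ∧-false-intro λ Se St →
  let loopFree , partners = isMatching-at S ok e Se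
  in  no-loop-no-partner loopFree (partners (tgt e) St) (disjointᵇ-tgt e)
  where
  no-loop-no-partner : ∀ {b c} → not b ≡ true → (b ∨ c) ≡ true → c ≡ false → ⊥
  no-loop-no-partner {false} {false} _ () _

chosen-not-consecutive : ∀ {m} (S : Subset m) → NoConsecutive S → ∀ {e f} →
  lookup S e ≡ true → lookup S f ≡ true → tgt e ≢ f
chosen-not-consecutive S noc {e} Se Sf tgte≡f with () ←
  trans (sym (cong₂ _∧_ Se (trans (cong (lookup S) tgte≡f) Sf))) (noc e)

-- Conversely, if no two chosen edges are consecutive, then distinct chosen edges are
-- disjoint: they share neither their source nor their target (tgt is injective).
noConsecutive⇒isMatching : ∀ {m} (S : Subset m) → NoConsecutive S → isMatching m S ≡ true
noConsecutive⇒isMatching {m} S noc = allᵇ-intro _ (allFin m) edgeOK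
  where
  partnerOK : ∀ e → lookup S e ≡ true → ∀ f → (not (lookup S f) ∨ ⌊ e Fin.≟ f ⌋ ∨ disjointᵇ e f) ≡ true
  partnerOK e Se f with lookup S f in Sf | e Fin.≟ f
  ... | false | _       = refl
  ... | true  | yes _   = refl
  ... | true  | no e≢f  = cong₂ _∧_ (≠ᵇ-true (chosen-not-consecutive S noc Sf Se ∘ sym))
    (cong₂ _∧_ (≠ᵇ-true (chosen-not-consecutive S noc Se Sf)) (≠ᵇ-true (e≢f ∘ tgt-injective)))
  edgeOK : ∀ e → (not (lookup S e) ∨ (not (isLoop e) ∧ partnersOKᵇ S e)) ≡ true
  edgeOK e with lookup S e in Se
  ... | false = refl
  ... | true  = cong₂ _∧_ (≠ᵇ-true (chosen-not-consecutive S noc Se Se ∘ sym)) (allᵇ-intro _ (allFin m) (partnerOK e Se))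

-- The words p t₁ … t_k f without adjacent trues are those where p ∷ T and T ∷ʳ f never
-- have a true at the same position.
DisjointWords : ∀ {n} → Vec Bool n → Vec Bool n → Set
DisjointWords u v = ∀ e → (lookup u e ∧ lookup v e) ≡ false

noAdjacent⇒disjoint : ∀ p {k} (T : Vec Bool k) f → noAdjacentᵇ p T f ≡ true → DisjointWords (p ∷ T) (T ∷ʳ f)
noAdjacent⇒disjoint false []      f     ok zero    = refl
noAdjacent⇒disjoint true  []      false ok zero    = refl
noAdjacent⇒disjoint false (t ∷ T) f     ok zero    = refl
noAdjacent⇒disjoint true  (false ∷ T) f ok zero    = refl
noAdjacent⇒disjoint p     (t ∷ T) f     ok (suc e) = noAdjacent⇒disjoint t T f (proj₂ (∧-split ok)) e

disjoint⇒noAdjacent : ∀ p {k} (T : Vec Bool k) f → DisjointWords (p ∷ T) (T ∷ʳ f) → noAdjacentᵇ p T f ≡ true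
disjoint⇒noAdjacent false []          f     _  = refl
disjoint⇒noAdjacent true  []          false _  = refl
disjoint⇒noAdjacent true  []          true  dj with () ← dj zero
disjoint⇒noAdjacent false (t ∷ T)     f     dj = disjoint⇒noAdjacent t T f (dj ∘ suc)
disjoint⇒noAdjacent true  (false ∷ T) f     dj = disjoint⇒noAdjacent false T f (dj ∘ suc)
disjoint⇒noAdjacent true  (true ∷ T)  f     dj with () ← dj zero

-- A subset of the edges of C_{k+1}, read as the cyclic word s t₁ … t_k s, is a matching
-- exactly when this word has no two adjacent trues.
isMatching≡noAdjacent : ∀ {k} (s : Bool) (T : Vec Bool k) → isMatching (suc k) (s ∷ T) ≡ noAdjacentᵇ s T s
isMatching≡noAdjacent s T = ≡-true-ext
  (λ ok → disjoint⇒noAdjacent s T s λ e →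
     subst (λ b → (lookup (s ∷ T) e ∧ b) ≡ false) (lookup-tgt s T e) (isMatching⇒noConsecutive (s ∷ T) ok e))
  (λ ok → noConsecutive⇒isMatching (s ∷ T) λ e →
     subst (λ b → (lookup (s ∷ T) e ∧ b) ≡ false) (sym (lookup-tgt s T e)) (noAdjacent⇒disjoint s T s ok e))

term : ℕ → ℕ → Poly
term d j = signedTerm j (d ∸ 2 ℕ.* j)

twice-bound : ∀ e j n → e ℕ.+ j ℕ.+ j ≡ n → (2 ℕ.* j ≤ n) × (n ∸ 2 ℕ.* j ≡ e)
twice-bound e j n refl rewrite ℕP.+-assoc e j j | ℕP.+-identityʳ j =
  ℕP.m≤n+m (j ℕ.+ j) e , ℕP.m+n∸n≡m e (j ℕ.+ j)

∣∷ʳ∣ : ∀ {k} s (T : Vec Bool k) → ∣ T ∷ʳ s ∣ ≡ ∣ s ∷ T ∣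
∣∷ʳ∣ s     []          = refl
∣∷ʳ∣ false (false ∷ T) = ∣∷ʳ∣ false T
∣∷ʳ∣ true  (false ∷ T) = ∣∷ʳ∣ true T
∣∷ʳ∣ false (true ∷ T)  = cong suc (∣∷ʳ∣ false T)
∣∷ʳ∣ true  (true ∷ T)  = cong suc (∣∷ʳ∣ true T)

cyclicWeight-matching : ∀ {k} s (T : Vec Bool k) → noAdjacentᵇ s T s ≡ true →
  (2 ℕ.* ∣ s ∷ T ∣ ≤ suc k) × (pathWeight s T s ≈P term (suc k) ∣ s ∷ T ∣)
cyclicWeight-matching {k} s T ok with pathWeight-noAdjacent s T s ok
... | e , steps , w≈ rewrite ∣∷ʳ∣ s T with twice-bound e ∣ s ∷ T ∣ (suc k) steps
... | 2j≤ , k+1∸2j≡e = 2j≤ , ≈P-trans w≈ (signedTerm-congʳ ∣ s ∷ T ∣ (sym k+1∸2j≡e))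

matching-size : ∀ k (M : Subset (suc k)) → M ∈ matchings (suc k) → 2 ℕ.* ∣ M ∣ ≤ suc k
matching-size k (s ∷ T) M∈ = proj₁ (cyclicWeight-matching s T
  (trans (sym (isMatching≡noAdjacent s T))
         (Equivalence.to BoolP.T-≡ (proj₂ (∈-filter⁻ (T? ∘ isMatching (suc k)) {xs = allSubsets (suc k)} M∈)))))

matching-sum : ∀ k → sumList (matchings (suc k)) (λ M → term (suc k) ∣ M ∣) ≈P cyclePoly k
matching-sum k = begin
  sumList (matchings (suc k)) (λ M → term (suc k) ∣ M ∣)
    ≈⟨ sumList-filter (isMatching (suc k)) (allSubsets (suc k)) _ ⟩
  sumList (allSubsets (suc k)) (λ S → if isMatching (suc k) S then term (suc k) ∣ S ∣ else zeroP)
    ≈⟨ sumList-cong (allSubsets (suc k)) (λ S _ → weight S) ⟩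
  sumList (allSubsets (suc k)) cyclicWeight
    ≈⟨ ≈P-trans (sumList-allSubsets k cyclicWeight) (sumList-⊕ (allSubsets k) _ _) ⟩
  trace k
    ≈⟨ trace≈cyclePoly k ⟩
  cyclePoly k ∎
  where
  open SetoidReasoning polySetoid
  cyclicWeight : Vec Bool (suc k) → Poly
  cyclicWeight (s ∷ T) = pathWeight s T s
  weight : ∀ S → (if isMatching (suc k) S then term (suc k) ∣ S ∣ else zeroP) ≈P cyclicWeight S
  weight (s ∷ T) rewrite isMatching≡noAdjacent s T with noAdjacentᵇ s T s in ok
  ... | false = ≈P-sym (pathWeight-adjacent s T s ok)
  ... | true  = ≈P-sym (proj₂ (cyclicWeight-matching s T ok))

-- d_n = (n+1 choose 2) = 1 + 2 + … + n is the degree of ∏_{m≤n} (1 + q^m).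
degree : ℕ → ℕ
degree n = suc n C 2

degree-suc : ∀ n → degree (suc n) ≡ degree n ℕ.+ suc n
degree-suc n = trans (sym (nCk+nC[k+1]≡[n+1]C[k+1] (suc n) 1))
                     (trans (cong (ℕ._+ degree n) (nC1≡n (suc n))) (ℕP.+-comm (suc n) (degree n)))

term-+ : ∀ x y a b → 2 ℕ.* a ≤ x → 2 ℕ.* b ≤ y → term (x ℕ.+ y) (a ℕ.+ b) ≈P (term x a ⊗ term y b)
term-+ x y a b 2a≤x 2b≤y =
  ≈P-trans (signedTerm-congʳ (a ℕ.+ b) degrees) (≈P-sym (signedTerm-⊗ a (x ∸ 2 ℕ.* a) b (y ∸ 2 ℕ.* b)))
  where
  open ≡-Reasoning
  degrees : (x ℕ.+ y) ∸ 2 ℕ.* (a ℕ.+ b) ≡ (x ∸ 2 ℕ.* a) ℕ.+ (y ∸ 2 ℕ.* b)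
  degrees = begin
    (x ℕ.+ y) ∸ 2 ℕ.* (a ℕ.+ b)              ≡⟨ cong ((x ℕ.+ y) ∸_) (ℕP.*-distribˡ-+ 2 a b) ⟩
    (x ℕ.+ y) ∸ (2 ℕ.* a ℕ.+ 2 ℕ.* b)        ≡⟨ ℕP.∸-+-assoc (x ℕ.+ y) (2 ℕ.* a) (2 ℕ.* b) ⟨
    (x ℕ.+ y) ∸ 2 ℕ.* a ∸ 2 ℕ.* b            ≡⟨ cong (_∸ 2 ℕ.* b) (ℕP.+-∸-comm y 2a≤x) ⟩
    ((x ∸ 2 ℕ.* a) ℕ.+ y) ∸ 2 ℕ.* b          ≡⟨ ℕP.+-∸-assoc (x ∸ 2 ℕ.* a) 2b≤y ⟩
    (x ∸ 2 ℕ.* a) ℕ.+ (y ∸ 2 ℕ.* b)          ∎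

∈-pairs⁻ : {A B : Set} (L : List B) (xs : List A) {t : A} {M : B} →
  (t , M) ∈ concatMap (λ t → map (λ M → t , M) L) xs → (t ∈ xs) × (M ∈ L)
∈-pairs⁻ L xs tM∈ with find (∈-concatMap⁻ (λ t → map (λ M → t , M) L) {xs = xs} tM∈)
... | t , t∈ , tM∈map with ∈-map⁻ (λ M → t , M) tM∈map
... | M , M∈ , refl = t∈ , M∈

totalEdges-bound : ∀ n t → t ∈ matchingTuples n → 2 ℕ.* totalEdges n t ≤ degree n
totalEdges-bound zero    _       _  = z≤n
totalEdges-bound (suc n) (t , M) t∈ with ∈-pairs⁻ (matchings (suc n)) (matchingTuples n) t∈
... | t∈′ , M∈ = subst (2 ℕ.* (totalEdges n t ℕ.+ ∣ M ∣) ≤_) (sym (degree-suc n))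
  (subst (ℕ._≤ degree n ℕ.+ suc n) (sym (ℕP.*-distribˡ-+ 2 (totalEdges n t) ∣ M ∣))
         (ℕP.+-mono-≤ (totalEdges-bound n t t∈′) (matching-size n M M∈)))

-- Multiplying out ∏_{m≤n} (1 + q^m), each factor expanded by the cycle identity:
-- h_n = Σ_{(M₁,…,M_n)} (-1)^E q^E (1+q)^(d_n - 2E), E the total number of edges.
prodPoly-expansion : ∀ n → prodPoly n ≈P sumList (matchingTuples n) (λ t → term (degree n) (totalEdges n t))
prodPoly-expansion zero    = ≈P-sym (≈P-trans (λ k → ℤP.+-identityʳ (term 0 0 k)) signedTerm-0-0)
prodPoly-expansion (suc n) = ≈P-sym (begin
  sumList (concatMap (λ t → map (λ M → t , M) Ms) ts) (λ t → term (degree (suc n)) (totalEdges (suc n) t))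
    ≈⟨ sumList-concatMap (λ t → map (λ M → t , M) Ms) ts _ ⟩
  sumList ts (λ t → sumList (map (λ M → t , M) Ms) (λ t → term (degree (suc n)) (totalEdges (suc n) t)))
    ≈⟨ sumList-cong ts (λ t _ → sumList-map (λ M → t , M) Ms _) ⟩
  sumList ts (λ t → sumList Ms (λ M → term (degree (suc n)) (totalEdges n t ℕ.+ ∣ M ∣)))
    ≈⟨ sumList-cong ts (λ t t∈ → sumList-cong Ms (λ M M∈ → factorise t M t∈ M∈)) ⟩
  sumList ts (λ t → sumList Ms (λ M → term (degree n) (totalEdges n t) ⊗ term (suc n) ∣ M ∣))
    ≈⟨ sumList-cong ts (λ t _ → ≈P-sym (sumList-⊗ (term (degree n) (totalEdges n t)) Ms _)) ⟩
  sumList ts (λ t → term (degree n) (totalEdges n t) ⊗ sumList Ms (λ M → term (suc n) ∣ M ∣))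
    ≈⟨ sumList-cong ts (λ t _ → ≈P-trans (⊗-congˡ (term (degree n) (totalEdges n t)) (matching-sum n))
                                                  (⊗-comm (term (degree n) (totalEdges n t)) (cyclePoly n))) ⟩
  sumList ts (λ t → cyclePoly n ⊗ term (degree n) (totalEdges n t))
    ≈⟨ sumList-⊗ (cyclePoly n) ts _ ⟨
  (cyclePoly n ⊗ sumList ts (λ t → term (degree n) (totalEdges n t)))
    ≈⟨ ≈P-trans (⊗-congˡ (cyclePoly n) (≈P-sym (prodPoly-expansion n))) (⊗-comm (cyclePoly n) (prodPoly n)) ⟩
  prodPoly (suc n) ∎)
  where
  open SetoidReasoning polySetoid
  ts = matchingTuples n
  Ms = matchings (suc n)
  factorise : ∀ t M → t ∈ ts → M ∈ Ms →
    term (degree (suc n)) (totalEdges n t ℕ.+ ∣ M ∣) ≈P (term (degree n) (totalEdges n t) ⊗ term (suc n) ∣ M ∣)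
  factorise t M t∈ M∈ = ≈P-trans
    (signedTerm-congʳ (totalEdges n t ℕ.+ ∣ M ∣) (cong (_∸ 2 ℕ.* (totalEdges n t ℕ.+ ∣ M ∣)) (degree-suc n)))
    (term-+ (degree n) (suc n) (totalEdges n t) ∣ M ∣ (totalEdges-bound n t t∈) (matching-size n M M∈))

γBasis : ℕ → ℕ → Poly
γBasis d j = X^ j ⊗ (onePlusQ ^P (d ∸ 2 ℕ.* j))

gammaExpansion-sumFin : ∀ d (γ : Fin (suc (d / 2)) → ℤ) →
  gammaExpansion d γ ≈P sumFin (suc (d / 2)) (λ i → scale (γ i) (γBasis d (toℕ i)))
gammaExpansion-sumFin d γ k =
  cong (λ p → p k) (foldr-allFin (suc (d / 2)) (λ i → scale (γ i) (γBasis d (toℕ i))))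

Unitriangular : (ℕ → Poly) → Set
Unitriangular B = (∀ j k → k < j → B j k ≡ + 0) × (∀ j → B j j ≡ + 1)

γBasis-unitriangular : ∀ d → Unitriangular (γBasis d)
γBasis-unitriangular d =
  (λ j k → X^-⊗-below j (onePlusQ ^P (d ∸ 2 ℕ.* j)) k) ,
  (λ j → trans (X^-⊗-at j (onePlusQ ^P (d ∸ 2 ℕ.* j))) (^P-constant (d ∸ 2 ℕ.* j)))
  where
  X^-⊗-below : ∀ j p k → k < j → (X^ j ⊗ p) k ≡ + 0
  X^-⊗-below (suc j) p zero    _         = X^-suc-⊗ j p zero
  X^-⊗-below (suc j) p (suc k) (s≤s k<j) = trans (X^-suc-⊗ j p (suc k)) (X^-⊗-below j p k k<j)
  X^-⊗-at : ∀ j p → (X^ j ⊗ p) j ≡ p 0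
  X^-⊗-at zero    p = ℤP.*-identityˡ (p 0)
  X^-⊗-at (suc j) p = trans (X^-suc-⊗ j p (suc j)) (X^-⊗-at j p)
  ^P-constant : ∀ e → (onePlusQ ^P e) 0 ≡ + 1
  ^P-constant zero    = refl
  ^P-constant (suc e) = cong (+ 1 *_) (^P-constant e)

unitriangular-independent : ∀ {B} → Unitriangular B → ∀ N o (c : Fin N → ℤ) →
  sumFin N (λ i → scale (c i) (B (o ℕ.+ toℕ i))) ≈P zeroP → ∀ i → c i ≡ + 0
unitriangular-independent {B} (below , diag) (suc N) o c sum≈0 = coefficients
  where
  rest : Poly
  rest = sumFin N (λ i → scale (c (suc i)) (B (o ℕ.+ suc (toℕ i))))
  rest-o : ∀ M (c′ : Fin M → ℤ) (ix : Fin M → ℕ) → (∀ i → o < ix i) →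
           sumFin M (λ i → scale (c′ i) (B (ix i))) o ≡ + 0
  rest-o zero    c′ ix o<ix = refl
  rest-o (suc M) c′ ix o<ix = cong₂ _+_
    (trans (cong (c′ zero *_) (below (ix zero) o (o<ix zero))) (ℤP.*-zeroʳ (c′ zero)))
    (rest-o M (λ i → c′ (suc i)) (λ i → ix (suc i)) (λ i → o<ix (suc i)))
  c₀≡0 : c zero ≡ + 0
  c₀≡0 = begin
    c zero                                ≡⟨ ℤP.*-identityʳ (c zero) ⟨
    c zero * + 1                          ≡⟨ cong (c zero *_) (trans (cong (λ j → B j o) (ℕP.+-identityʳ o)) (diag o)) ⟨
    c zero * B (o ℕ.+ 0) o                ≡⟨ ℤP.+-identityʳ _ ⟨
    c zero * B (o ℕ.+ 0) o + + 0          ≡⟨ cong (_+_ (c zero * B (o ℕ.+ 0) o))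
                                               (rest-o N (λ i → c (suc i)) (λ i → o ℕ.+ suc (toℕ i))
                                                  (λ i → ℕP.m<m+n o (s≤s z≤n))) ⟨
    c zero * B (o ℕ.+ 0) o + rest o       ≡⟨ sum≈0 o ⟩
    + 0                                   ∎
    where open ≡-Reasoning
  tail≈0 : sumFin N (λ i → scale (c (suc i)) (B (suc o ℕ.+ toℕ i))) ≈P zeroP
  tail≈0 k = trans (sumFin-cong N (λ i k′ → cong (λ j → c (suc i) * B j k′) (sym (ℕP.+-suc o (toℕ i)))) k)
    (trans (sym (ℤP.+-identityˡ (rest k)))
    (trans (cong (_+ rest k) (sym (trans (cong (_* B (o ℕ.+ 0) k) c₀≡0) (ℤP.*-zeroˡ (B (o ℕ.+ 0) k)))))
    (sum≈0 k)))
  coefficients : ∀ i → c i ≡ + 0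
  coefficients zero    = c₀≡0
  coefficients (suc i) = unitriangular-independent (below , diag) N (suc o) (λ i → c (suc i)) tail≈0 i

gammaVector-unique : ∀ h d (γ γ′ : Fin (suc (d / 2)) → ℤ) →
  IsGammaVector h d γ → IsGammaVector h d γ′ → ∀ i → γ i ≡ γ′ i
gammaVector-unique h d γ γ′ hγ hγ′ i = ℤP.i-j≡0⇒i≡j (γ i) (γ′ i)
  (unitriangular-independent (γBasis-unitriangular d) (suc N) 0 (λ i → γ i - γ′ i) difference≈0 i)
  where
  N = d / 2
  B : Fin (suc N) → Poly
  B i = γBasis d (toℕ i)
  difference≈0 : sumFin (suc N) (λ i → scale (γ i - γ′ i) (B i)) ≈P zeroP
  difference≈0 k = begin-equality
    sumFin (suc N) (λ i → scale (γ i - γ′ i) (B i)) k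
      ≡⟨ sumFin-cong (suc N) (λ i k′ → trans (ℤP.*-distribʳ-+ (B i k′) (γ i) (- γ′ i))
                                             (cong (_+_ (γ i * B i k′)) (sym (ℤP.neg-distribˡ-* (γ′ i) (B i k′))))) k ⟩
    sumFin (suc N) (λ i → scale (γ i) (B i) ⊕ negP (scale (γ′ i) (B i))) k
      ≡⟨ sumFin-⊕ (suc N) (λ i → scale (γ i) (B i)) (λ i → negP (scale (γ′ i) (B i))) k ⟩
    sumFin (suc N) (λ i → scale (γ i) (B i)) k + sumFin (suc N) (λ i → negP (scale (γ′ i) (B i))) k
      ≡⟨ cong₂ _+_ (sym (trans (hγ k) (gammaExpansion-sumFin d γ k)))
                               (trans (sumFin-neg (suc N) (λ i → scale (γ′ i) (B i)) k)
                                      (cong -_ (sym (trans (hγ′ k) (gammaExpansion-sumFin d γ′ k))))) ⟩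
    h k - h k
      ≡⟨ ℤP.+-inverseʳ (h k) ⟩
    + 0 ∎
    where open ≡-Reasoning renaming (begin_ to begin-equality_)

-- 2e ≤ d gives e ≤ ⌊d/2⌋, so total edge counts index the γ-vector.
half : ∀ {e d} → 2 ℕ.* e ≤ d → e ≤ d / 2
half {e} {d} 2e≤d = subst (_≤ d / 2) (trans (cong (_/ 2) (ℕP.*-comm 2 e)) (ℕD.m*n/n≡m e 2)) (ℕD./-monoˡ-≤ 2 2e≤d)

gammaVector : (n : ℕ) → Fin (suc (degree n / 2)) → ℤ
gammaVector n i = ((- + 1) ^ toℕ i) * (+ countTuples n (toℕ i))

prodPoly-gammaVector : ∀ n → IsGammaVector (prodPoly n) (degree n) (gammaVector n)
prodPoly-gammaVector n = begin
  prodPoly n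
    ≈⟨ prodPoly-expansion n ⟩
  sumList (matchingTuples n) (λ t → term d (totalEdges n t))
    ≈⟨ sumList-groupBy (totalEdges n) (term d) (d / 2) (matchingTuples n)
                       (λ t t∈ → half (totalEdges-bound n t t∈)) ⟩
  sumFin (suc (d / 2)) (λ i → scale (+ countTuples n (toℕ i)) (term d (toℕ i)))
    ≈⟨ sumFin-cong (suc (d / 2)) (λ i k → move-sign (+ countTuples n (toℕ i)) (sign (toℕ i)) (γBasis d (toℕ i) k)) ⟩
  sumFin (suc (d / 2)) (λ i → scale (gammaVector n i) (γBasis d (toℕ i)))
    ≈⟨ gammaExpansion-sumFin d (gammaVector n) ⟨
  gammaExpansion d (gammaVector n) ∎
  where
  open SetoidReasoning polySetoid
  d = degree n
  move-sign : ∀ c s x → c * (s * x) ≡ (s * c) * x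
  move-sign c s x = trans (sym (ℤP.*-assoc c s x)) (cong (_* x) (ℤP.*-comm c s))

-- The theorem: the claimed vector is a γ-vector of h_n, and every γ-vector of h_n equals it.
corollary3p5 : (n : ℕ) → 1 ≤ n →
    IsGammaVector (prodPoly n) (suc n C 2) (λ i → ((- + 1) ^ toℕ i) * (+ countTuples n (toℕ i)))
    × ((γ : Fin (suc ((suc n C 2) / 2)) → ℤ) →
         IsGammaVector (prodPoly n) (suc n C 2) γ →
         (i : Fin (suc ((suc n C 2) / 2))) →
         γ i ≡ ((- + 1) ^ toℕ i) * (+ countTuples n (toℕ i)))
corollary3p5 n _ =
  prodPoly-gammaVector n ,
  λ γ isγ → gammaVector-unique (prodPoly n) (degree n) γ (gammaVector n) isγ (prodPoly-gammaVector n)
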